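{- For any finite, simple, connected, undirected graph $G$ of order $n \ge 3$, $Z(C(G, \mathrm{id})) \le \min\{2Z(G), n\}$, where $\mathrm{id}$ is the identity map $V(G_1)\to V(G_2)$ (sending each vertex of $G_1$ to its copy in $G_2$).
   Context: Zero forcing: color each vertex of a graph $H$ black or white, with $S$ the initial set of black vertices. The color-change rule turns a white vertex $u_2$ black if $u_2$ is the only white neighbor of some black vertex $u_1$. $S$ is a zero forcing set of $H$ if all vertices become black after finitely many applications of the rule. $Z(H)$ is the minimum size of a zero forcing set of $H$. Functigraph: given disjoint copies $G_1,G_2$ of $G$ and $f:V(G_1)\to V(G_2)$, $C(G,f)$ has vertex set $V(G_1)\cup V(G_2)$ and edge set $E(G_1)\cup E(G_2)\cup\{uv \mid v=f(u)\}$. -}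

module Defs where

open import Data.Nat using (ℕ; _+_)
open import Data.Fin using (Fin; splitAt)
open import Data.Fin.Subset using (Subset; _∈_; ∣_∣)
open import Data.Sum using (_⊎_; inj₁; inj₂)
open import Data.Product using (Σ; _×_; _,_)
open import Data.Empty using (⊥)
open import Relation.Nullary using (¬_)
open import Relation.Binary.PropositionalEquality using (_≡_; _≢_)
open import Relation.Binary.Construct.Closure.ReflexiveTransitive using (Star)
open import Data.Nat using (_≤_)

Rel : ℕ → Set₁
Rel n = Fin n → Fin n → Set

record SimpleGraph (n : ℕ) : Set₁ where
  field
    Adj   : Rel n
    sym   : ∀ {u v} → Adj u v → Adj v u
    irrefl : ∀ {u} → ¬ Adj u u

Connected : {n : ℕ} → Rel n → Set
Connected {n} Adj = (u v : Fin n) → Star Adj u v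

-- Zero forcing. Black Adj S v : vertex v eventually becomes black starting
-- from the initial black set S, by repeated application of the colour-change
-- rule (the inductive closure of the rule).
data Black {n : ℕ} (Adj : Rel n) (S : Subset n) : Fin n → Set where
  initial : ∀ {v} → v ∈ S → Black Adj S v
  force   : ∀ {u v} → Black Adj S u → Adj u v
          → (∀ w → Adj u w → w ≢ v → Black Adj S w)
          → Black Adj S v

ZeroForcingSet : {n : ℕ} → Rel n → Subset n → Set
ZeroForcingSet {n} Adj S = (v : Fin n) → Black Adj S v

IsZ : {n : ℕ} → Rel n → ℕ → Set
IsZ {n} Adj k =
  Σ (Subset n) (λ S → ZeroForcingSet Adj S × ∣ S ∣ ≡ k)
  × ((S : Subset n) → ZeroForcingSet Adj S → k ≤ ∣ S ∣)

-- Adjacency of the functigraph C(G, f) on vertex set Fin (n + n):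
-- the first n vertices are G₁, the last n are G₂ (via splitAt).
FunAdj' : {n : ℕ} → Rel n → (Fin n → Fin n) → Fin n ⊎ Fin n → Fin n ⊎ Fin n → Set
FunAdj' Adj f (inj₁ a) (inj₁ b) = Adj a b
FunAdj' Adj f (inj₂ a) (inj₂ b) = Adj a b
FunAdj' Adj f (inj₁ a) (inj₂ b) = b ≡ f a
FunAdj' Adj f (inj₂ b) (inj₁ a) = b ≡ f a

FunAdj : {n : ℕ} → Rel n → (Fin n → Fin n) → Rel (n + n)
FunAdj {n} Adj f x y = FunAdj' Adj f (splitAt n x) (splitAt n y)

-- A zero forcing set T of G, copied into both layers, forces C(G, id): each force
-- u → v of G can be replayed in both copies, because the only extra neighbour of
-- a copy of u is the other copy of u, which is black by then.  Alternatively, the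
-- whole first layer is a zero forcing set, since every vertex of G₁ has exactly one
-- neighbour in G₂.  Neither argument uses connectivity or n ≥ 3.
module Submission where

open import Defs
open import Data.Nat using (ℕ; _≤_; _*_)
open import Data.Nat using (_⊓_)
open import Data.Fin using (Fin)
open import Function using (id; _∘_)

open import Data.Nat using (suc; _+_)
open import Data.Nat.Properties using (⊓-glb; +-identityʳ)
open import Data.Fin using (splitAt; join; _↑ˡ_; _↑ʳ_)
open import Data.Fin.Properties using (splitAt-join; join-splitAt)
open import Data.Fin.Subset using (Subset; inside; outside; ⊤; ⊥; ∣_∣; _∈_)
open import Data.Fin.Subset.Properties using (∈⊤; ∣⊤∣≡n; ∣⊥∣≡0)
open import Data.Vec using ([]; _∷_; _++_)
open import Data.Vec.Properties using (lookup-++ˡ; lookup-++ʳ; []=⇒lookup; lookup⇒[]=)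
open import Data.Sum using (_⊎_; inj₁; inj₂)
open import Data.Product using (_×_; _,_; proj₁; proj₂)
open import Relation.Binary.PropositionalEquality
open import Relation.Nullary using (contradiction)

∣p++q∣≡∣p∣+∣q∣ : ∀ {m n} (p : Subset m) (q : Subset n) → ∣ p ++ q ∣ ≡ ∣ p ∣ + ∣ q ∣
∣p++q∣≡∣p∣+∣q∣ []            q = refl
∣p++q∣≡∣p∣+∣q∣ (inside  ∷ p) q = cong suc (∣p++q∣≡∣p∣+∣q∣ p q)
∣p++q∣≡∣p∣+∣q∣ (outside ∷ p) q = ∣p++q∣≡∣p∣+∣q∣ p q

x∈p⇒x↑ˡ∈p++q : ∀ {m n} {p : Subset m} (q : Subset n) {x : Fin m} → x ∈ p → x ↑ˡ n ∈ p ++ q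
x∈p⇒x↑ˡ∈p++q {p = p} q {x} x∈p =
  lookup⇒[]= (x ↑ˡ _) (p ++ q) (trans (lookup-++ˡ p q x) ([]=⇒lookup x∈p))

x∈q⇒m↑ʳx∈p++q : ∀ {m n} (p : Subset m) {q : Subset n} {x : Fin n} → x ∈ q → m ↑ʳ x ∈ p ++ q
x∈q⇒m↑ʳx∈p++q {m} p {q} {x} x∈q =
  lookup⇒[]= (m ↑ʳ x) (p ++ q) (trans (lookup-++ʳ p q x) ([]=⇒lookup x∈q))

module Functigraph {n : ℕ} (Adj : Rel n) (f : Fin n → Fin n) where

  C : Rel (n + n)
  C = FunAdj Adj f

  vertex : Fin n ⊎ Fin n → Fin (n + n)
  vertex = join n n

  ∀-vertex : (P : Fin (n + n) → Set) → (∀ x → P (vertex x)) → ∀ w → P w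
  ∀-vertex P h w = subst P (join-splitAt n n w) (h (splitAt n w))

  adj⁻ : ∀ x y → C (vertex x) (vertex y) → FunAdj' Adj f x y
  adj⁻ x y = subst₂ (FunAdj' Adj f) (splitAt-join n n x) (splitAt-join n n y)

  adj⁺ : ∀ x y → FunAdj' Adj f x y → C (vertex x) (vertex y)
  adj⁺ x y = subst₂ (FunAdj' Adj f) (sym (splitAt-join n n x)) (sym (splitAt-join n n y))

  force-vertex : ∀ {S} x y → Black C S (vertex x) → FunAdj' Adj f x y
    → (∀ z → FunAdj' Adj f x z → z ≢ y → Black C S (vertex z))
    → Black C S (vertex y)
  force-vertex x y bx xy others =
    force bx (adj⁺ x y xy)
      (∀-vertex _ λ z xz z≢y → others z (adj⁻ x z xz) (z≢y ∘ cong vertex))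

module IdentityFunctigraph {n : ℕ} (Adj : Rel n) where

  open Functigraph Adj id public

  module _ (T : Subset n) where

    black-in-both-copies : ∀ {v} → Black Adj T v
      → Black C (T ++ T) (vertex (inj₁ v)) × Black C (T ++ T) (vertex (inj₂ v))
    black-in-both-copies (initial v∈T) =
      initial (x∈p⇒x↑ˡ∈p++q T v∈T) , initial (x∈q⇒m↑ʳx∈p++q T v∈T)
    black-in-both-copies {v} (force {u} bu uv others) =
      force-vertex (inj₁ u) (inj₁ v) bu₁ uv others₁ , force-vertex (inj₂ u) (inj₂ v) bu₂ uv others₂
      where
        bu₁ = proj₁ (black-in-both-copies bu)
        bu₂ = proj₂ (black-in-both-copies bu)
        others₁ : ∀ z → FunAdj' Adj id (inj₁ u) z → z ≢ inj₁ v → Black C (T ++ T) (vertex z)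
        others₁ (inj₁ w) uw w≢v = proj₁ (black-in-both-copies (others w uw (w≢v ∘ cong inj₁)))
        others₁ (inj₂ w) refl _ = bu₂
        others₂ : ∀ z → FunAdj' Adj id (inj₂ u) z → z ≢ inj₂ v → Black C (T ++ T) (vertex z)
        others₂ (inj₁ w) refl _ = bu₁
        others₂ (inj₂ w) uw w≢v = proj₂ (black-in-both-copies (others w uw (w≢v ∘ cong inj₂)))

    zeroForcing-doubled : ZeroForcingSet Adj T → ZeroForcingSet C (T ++ T)
    zeroForcing-doubled zf = ∀-vertex _ λ where
      (inj₁ v) → proj₁ (black-in-both-copies (zf v))
      (inj₂ v) → proj₂ (black-in-both-copies (zf v))

  firstLayer : Subset (n + n)
  firstLayer = ⊤ {n} ++ ⊥ {n}

  ∣firstLayer∣≡n : ∣ firstLayer ∣ ≡ n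
  ∣firstLayer∣≡n = begin
    ∣ firstLayer ∣        ≡⟨ ∣p++q∣≡∣p∣+∣q∣ (⊤ {n}) (⊥ {n}) ⟩
    ∣ ⊤ {n} ∣ + ∣ ⊥ {n} ∣ ≡⟨ cong₂ _+_ (∣⊤∣≡n n) (∣⊥∣≡0 n) ⟩
    n + 0                 ≡⟨ +-identityʳ n ⟩
    n                     ∎
    where open ≡-Reasoning

  zeroForcing-firstLayer : ZeroForcingSet C firstLayer
  zeroForcing-firstLayer = ∀-vertex _ black
    where
      black : ∀ x → Black C firstLayer (vertex x)
      black (inj₁ v) = initial (x∈p⇒x↑ˡ∈p++q (⊥ {n}) ∈⊤)
      black (inj₂ v) = force-vertex (inj₁ v) (inj₂ v) (black (inj₁ v)) refl λ where
        (inj₁ w) _    _    → black (inj₁ w)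
        (inj₂ w) refl w≢v → contradiction refl w≢v

corollary3p4 : (n : ℕ) → 3 ≤ n → (G : SimpleGraph n)
    → Connected (SimpleGraph.Adj G)
    → (z zc : ℕ) → IsZ (SimpleGraph.Adj G) z
    → IsZ (FunAdj (SimpleGraph.Adj G) id) zc
    → zc ≤ (2 * z) ⊓ n
corollary3p4 n _ G _ z zc ((T , zfT , refl) , _) (_ , minimal) =
  ⊓-glb (subst (zc ≤_) ∣T++T∣≡2*∣T∣ (minimal _ (zeroForcing-doubled T zfT)))
        (subst (zc ≤_) ∣firstLayer∣≡n (minimal _ zeroForcing-firstLayer))
  where
    open IdentityFunctigraph (SimpleGraph.Adj G)
    open ≡-Reasoning
    ∣T++T∣≡2*∣T∣ : ∣ T ++ T ∣ ≡ 2 * ∣ T ∣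
    ∣T++T∣≡2*∣T∣ = begin
      ∣ T ++ T ∣            ≡⟨ ∣p++q∣≡∣p∣+∣q∣ T T ⟩
      ∣ T ∣ + ∣ T ∣         ≡⟨ cong (∣ T ∣ +_) (sym (+-identityʳ ∣ T ∣)) ⟩
      2 * ∣ T ∣             ∎
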